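{- Let $H$ be a graph with $\chi(H)\geqslant 3$, and let $f:\mathbb{N}\to\mathbb{R}$ satisfy $f(n)=o(n)$. For every $C$ and $n_1$ there exists an $H$-free graph $G$ on at least $n_1$ vertices with $\delta(G)\geqslant f(v(G))$ and $\chi(G)\geqslant C$.
   Context: All graphs are finite and simple; $G$ is $H$-free if it has no subgraph isomorphic to $H$; $v(G)$ is the number of vertices and $\delta(G)$ the minimum degree of $G$.
   Formalization: The function f takes rational values instead of real values. -}

module Defs where

open import Data.Nat using (ℕ; _<_; _≤_; _+_)
open import Data.Bool using (Bool; true; false; if_then_else_)
open import Data.Fin using (Fin)
open import Data.List using (List; map; allFin)
open import Data.Nat.ListAction using (sum)
open import Data.Product using (Σ; ∃; _×_)
open import Relation.Binary.PropositionalEquality using (_≡_)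
open import Relation.Nullary using (¬_)
open import Function.Definitions using (Injective)
import Data.Rational as ℚ
open import Data.Integer using (+_)

record Graph : Set where
  field
    size  : ℕ
    adj   : Fin size → Fin size → Bool
    sym   : ∀ u v → adj u v ≡ adj v u
    irrefl : ∀ v → adj v v ≡ false
open Graph public

v : Graph → ℕ
v G = size G

Adj : (G : Graph) → Fin (size G) → Fin (size G) → Set
Adj G u w = adj G u w ≡ true

degree : (G : Graph) → Fin (size G) → ℕ
degree G u = sum (map (λ w → if adj G u w then 1 else 0) (allFin (size G)))

SubgraphOf : Graph → Graph → Set
SubgraphOf H G =
  Σ (Fin (size H) → Fin (size G)) λ φ →
    Injective _≡_ _≡_ φ × (∀ a b → Adj H a b → Adj G (φ a) (φ b))

Free : Graph → Graph → Set
Free H G = ¬ SubgraphOf H G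

ProperColouring : (G : Graph) → ℕ → Set
ProperColouring G k =
  Σ (Fin (size G) → Fin k) λ c → ∀ a b → Adj G a b → ¬ (c a ≡ c b)

χ≥ : Graph → ℕ → Set
χ≥ G C = ∀ k → k < C → ¬ ProperColouring G k

δ≥ : Graph → ℚ.ℚ → Set
δ≥ G x = ∀ u → x ℚ.≤ (+ degree G u) ℚ./ 1

LittleO-n : (ℕ → ℚ.ℚ) → Set
LittleO-n f = ∀ (k : ℕ) → ∃ λ (N : ℕ) → ∀ n → N ≤ n →
  ℚ.∣ f n ∣ ℚ.≤ (+ n) ℚ./ (1 + k)

module Submission where

-- G is a blow-up of a shift graph.  The shift graph S(K, m) has as vertices
-- the sequences x₀ … x_K of numbers below m, with an arc x → y when
-- x₀ < x₁ < ⋯ < x_K < y_K and y is x shifted one place to the left.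
--   (1) χ(S(K, m)) > C once m > tower K C: a c-colouring of S(K + 1, m)
--       induces a 2^c-colouring of S(K, m) (colour u by the set of colours of
--       its one-entry extensions), and S(0, m) is the complete graph K_m.
--   (2) S(K, m) has no odd closed walk of length L with 2L ≤ K: along a walk
--       the entries get shifted by its length minus twice its backward steps.
-- Replacing each vertex of S(K, m) having a neighbour by t copies gives a graph
-- on n = M · t vertices (M = m ^ (K + 1)) of minimum degree t ≥ n / (M + 1),
-- which is ≥ f(n) for t large, and it still has chromatic number > C.  A copy
-- of H in it maps homomorphically to S(K, m); for K ≥ 2(4h + 1) the graph H
-- then has no odd closed walks of length ≤ 4h + 1 and is 2-colourable
-- (colour by the parity of walks from the least vertex of the component),
-- contradicting χ(H) ≥ 3.

open import Defs hiding (sym)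
open import Data.Nat using (ℕ; _≤_)
open import Data.Product using (Σ; _×_)
open import Data.Rational using (ℚ)

open import Data.Nat as ℕ using (zero; suc; _+_; _*_; _∸_; _^_; _<_; _<?_; z≤n; s≤s)
import Data.Nat.Properties as ℕP
open import Data.Nat.Induction using (<-rec)
open import Data.Nat.Solver using (module +-*-Solver)
open import Data.Nat.ListAction using (sum)
open import Data.Fin as Fin using (Fin; zero; suc; toℕ; fromℕ; fromℕ<; funToFin; finToFun)
import Data.Fin.Properties as FinP
open import Data.Vec.Functional using (Vector; _∷_; head; tail; init; last; insertAt)
open import Data.List using (tabulate)
import Data.List.Properties as ListP
open import Data.Bool using (true; false; if_then_else_)
import Data.Bool as Bool
open import Data.Integer as ℤ using (+_; -[1+_])
import Data.Integer.Properties as ℤP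
import Data.Rational as ℚ
import Data.Rational.Properties as ℚP
import Data.Rational.Unnormalised as ℚᵘ
import Data.Rational.Unnormalised.Properties as ℚᵘP
open import Data.Product using (∃; _,_; proj₁; proj₂)
open import Data.Sum using (_⊎_; inj₁; inj₂; swap)
open import Relation.Nullary using (¬_; Dec; yes; no; contradiction)
open import Relation.Nullary.Decidable using (isYes; _×-dec_; _⊎-dec_; map′)
open import Relation.Binary using (tri<; tri≈; tri>)
open import Relation.Binary.PropositionalEquality
  using (_≡_; _≢_; _≗_; refl; sym; trans; cong; subst; subst₂; module ≡-Reasoning)
open import Function using (_∘_; id)

parity : ∀ n → ∃ λ a → n ≡ a + a ⊎ n ≡ suc (a + a)
parity zero = 0 , inj₁ refl
parity (suc n) with parity n
... | a , inj₁ refl = a , inj₂ refl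
... | a , inj₂ refl = suc a , inj₁ (cong suc (sym (ℕP.+-suc a a)))

odd≢even : ∀ a b → suc (a + a) ≢ b + b
odd≢even zero    zero    ()
odd≢even zero    (suc b) eq = ℕP.0≢1+n (trans (ℕP.suc-injective eq) (ℕP.+-suc b b))
odd≢even (suc a) zero    ()
odd≢even (suc a) (suc b) eq = odd≢even a b (ℕP.suc-injective (ℕP.suc-injective (begin
  suc (suc (suc (a + a)))  ≡⟨ cong (ℕ.suc ∘ ℕ.suc) (sym (ℕP.+-suc a a)) ⟩
  suc (suc a + suc a)      ≡⟨ eq ⟩
  suc b + suc b            ≡⟨ cong suc (ℕP.+-suc b b) ⟩
  suc (suc (b + b))        ∎)))
  where open ≡-Reasoning

least : ∀ {h} {P : Fin h → Set} → (∀ i → Dec (P i)) → ∃ P →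
        ∃ λ i → P i × (∀ j → j Fin.< i → ¬ P j)
least {suc h} P? witness with P? zero
... | yes p₀ = zero , p₀ , λ _ ()
... | no ¬p₀ with witness
...   | zero  , p = contradiction p ¬p₀
...   | suc i , p with least (P? ∘ suc) (i , p)
...     | k , pk , below = suc k , pk , λ { zero _ → ¬p₀ ; (suc j) (s≤s j<k) → below j j<k }

sum-tabulate-+ : ∀ b c (f : Fin (b + c) → ℕ) →
  sum (tabulate f) ≡ sum (tabulate (f ∘ (Fin._↑ˡ c))) + sum (tabulate (f ∘ (b Fin.↑ʳ_)))
sum-tabulate-+ zero    c f = refl
sum-tabulate-+ (suc b) c f =
  trans (cong (λ s → f zero + s) (sum-tabulate-+ b c (f ∘ suc))) (sym (ℕP.+-assoc (f zero) _ _))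

sum-block≤ : ∀ M t (f : Fin (M * t) → ℕ) (i : Fin M) →
  sum (tabulate (f ∘ Fin.combine i)) ≤ sum (tabulate f)
sum-block≤ (suc M) t f i = begin
    sum (tabulate (f ∘ Fin.combine i))
  ≤⟨ block i ⟩
    sum (tabulate (f ∘ (Fin._↑ˡ M * t))) + sum (tabulate (f ∘ (t Fin.↑ʳ_)))
  ≡⟨ sym (sum-tabulate-+ t (M * t) f) ⟩
    sum (tabulate f)
  ∎
  where
  open ℕP.≤-Reasoning
  block : ∀ i → sum (tabulate (f ∘ Fin.combine i)) ≤
                sum (tabulate (f ∘ (Fin._↑ˡ M * t))) + sum (tabulate (f ∘ (t Fin.↑ʳ_)))
  block zero    = ℕP.m≤m+n _ _
  block (suc i) = ℕP.≤-trans (sum-block≤ M t (f ∘ (t Fin.↑ʳ_)) i) (ℕP.m≤n+m _ _)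

t≤sum : ∀ t (g : Fin t → ℕ) → (∀ j → 1 ≤ g j) → t ≤ sum (tabulate g)
t≤sum zero    g one = z≤n
t≤sum (suc t) g one = ℕP.+-mono-≤ (one zero) (t≤sum t (g ∘ suc) (one ∘ suc))

bit : ∀ {P : Set} → Dec P → Fin 2
bit (yes _) = zero
bit (no _)  = suc zero

bit-same : ∀ {P Q : Set} (p : Dec P) (q : Dec Q) → bit p ≡ bit q → (P × Q) ⊎ (¬ P × ¬ Q)
bit-same (yes p) (yes q) _ = inj₁ (p , q)
bit-same (no ¬p) (no ¬q) _ = inj₂ (¬p , ¬q)

isYes-⇔ : ∀ {P Q : Set} → (P → Q) → (Q → P) → (p : Dec P) (q : Dec Q) → isYes p ≡ isYes q
isYes-⇔ _   _   (yes _) (yes _) = refl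
isYes-⇔ P⇒Q _   (yes p) (no ¬q) = contradiction (P⇒Q p) ¬q
isYes-⇔ _   Q⇒P (no ¬p) (yes q) = contradiction (Q⇒P q) ¬p
isYes-⇔ _   _   (no _)  (no _)  = refl

isYes-sound : ∀ {P : Set} (p : Dec P) → isYes p ≡ true → P
isYes-sound (yes p) _ = p

isYes-complete : ∀ {P : Set} (p : Dec P) → P → isYes p ≡ true
isYes-complete (yes _) _ = refl
isYes-complete (no ¬p) p = contradiction p ¬p

isYes-false : ∀ {P : Set} (p : Dec P) → ¬ P → isYes p ≡ false
isYes-false (yes p) ¬p = contradiction p ¬p
isYes-false (no _)  _  = refl

funToFin-pointwise : ∀ {c} {f g : Fin c → Fin 2} → funToFin f ≡ funToFin g → ∀ i → f i ≡ g i
funToFin-pointwise {f = f} {g} same i = begin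
  f i                     ≡⟨ FinP.finToFun-funToFin f i ⟨
  finToFun (funToFin f) i ≡⟨ cong (λ code → finToFun code i) same ⟩
  finToFun (funToFin g) i ≡⟨ FinP.finToFun-funToFin g i ⟩
  g i                     ∎
  where open ≡-Reasoning

data Walk {A : Set} (R : A → A → Set) : ℕ → A → A → Set where
  ε   : ∀ {a} → Walk R 0 a a
  _◅_ : ∀ {n a b c} → R a b → Walk R n b c → Walk R (suc n) a c

infixr 5 _◅_

module _ {A : Set} {R : A → A → Set} where

  infixr 5 _◅◅_
  _◅◅_ : ∀ {m n a b c} → Walk R m a b → Walk R n b c → Walk R (m + n) a c
  ε       ◅◅ w' = w'
  (e ◅ w) ◅◅ w' = e ◅ (w ◅◅ w')

  castWalk : ∀ {m n a b} → m ≡ n → Walk R m a b → Walk R n a b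
  castWalk refl w = w

  -- The i-th vertex of a walk (its last vertex once i exceeds the length).
  vertexAt : ∀ {n a b} → Walk R n a b → ℕ → A
  vertexAt {a = a} w       zero    = a
  vertexAt {b = b} ε       (suc i) = b
  vertexAt         (_ ◅ w) (suc i) = vertexAt w i

  takeWalk : ∀ {n a b} i → i ≤ n → (w : Walk R n a b) → Walk R i a (vertexAt w i)
  takeWalk zero    _         w       = ε
  takeWalk (suc i) (s≤s i≤n) (e ◅ w) = e ◅ takeWalk i i≤n w

  dropWalk : ∀ {n a b} i → i ≤ n → (w : Walk R n a b) → Walk R (n ∸ i) (vertexAt w i) b
  dropWalk zero    _         w       = w
  dropWalk (suc i) (s≤s i≤n) (e ◅ w) = dropWalk i i≤n w

mapWalk : ∀ {A B : Set} {R : A → A → Set} {S : B → B → Set} (f : A → B) →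
  (∀ {a b} → R a b → S (f a) (f b)) → ∀ {n a b} → Walk R n a b → Walk S n (f a) (f b)
mapWalk f hom ε       = ε
mapWalk f hom (e ◅ w) = hom e ◅ mapWalk f hom w

module _ {h : ℕ} {R : Fin h → Fin h → Set} where

  -- A walk with at least h steps visits some vertex twice (pigeonhole);
  -- cutting out the closed subwalk in between gives a strictly shorter walk.
  cutCycle : ∀ {n a b} → h ≤ n → Walk R n a b → ∃ λ n' → n' < n × Walk R n' a b
  cutCycle {n} {b = b} h≤n w with FinP.pigeonhole (s≤s h≤n) (λ k → vertexAt w (toℕ k))
  ... | i , j , i<j , same =
    toℕ i + (n ∸ toℕ j) , shorter ,
    takeWalk (toℕ i) i≤n w ◅◅ subst (λ x → Walk R (n ∸ toℕ j) x b) (sym same) (dropWalk (toℕ j) j≤n w)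
    where
    j≤n : toℕ j ≤ n
    j≤n = ℕP.≤-pred (FinP.toℕ<n j)
    i≤n : toℕ i ≤ n
    i≤n = ℕP.≤-trans (ℕP.<⇒≤ i<j) j≤n
    shorter : toℕ i + (n ∸ toℕ j) < n
    shorter = subst (toℕ i + (n ∸ toℕ j) <_) (ℕP.m+[n∸m]≡n j≤n) (ℕP.+-monoˡ-< (n ∸ toℕ j) i<j)

  shorten : ∀ {n a b} → Walk R n a b → ∃ λ n' → n' < h × Walk R n' a b
  shorten {n} = <-rec Shortenable go n
    where
    Shortenable : ℕ → Set
    Shortenable n = ∀ {a b} → Walk R n a b → ∃ λ n' → n' < h × Walk R n' a b
    go : ∀ n → (∀ {m} → m < n → Shortenable m) → Shortenable n
    go n rec w with n <? h
    ... | yes n<h = n , n<h , w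
    ... | no  n≮h with cutCycle (ℕP.≮⇒≥ n≮h) w
    ...   | n' , n'<n , w' = rec n'<n w'

-- A graph in which every closed walk of odd length at most 4h + 1 is
-- forbidden (h = number of vertices) is properly 2-colourable: colour each
-- vertex by the parity of walks to it from the least vertex of its component.
module TwoColouring (H : Graph) where

  private
    h : ℕ
    h = size H

  adj? : ∀ a b → Dec (Adj H a b)
  adj? a b = adj H a b Bool.≟ true

  adj-sym : ∀ {a b} → Adj H a b → Adj H b a
  adj-sym {a} {b} e = trans (Graph.sym H b a) e

  walk? : ∀ n a c → Dec (Walk (Adj H) n a c)
  walk? zero    a c = map′ (λ { refl → ε }) (λ { ε → refl }) (a FinP.≟ c)
  walk? (suc n) a c = map′ (λ { (b , e , w) → e ◅ w }) (λ { (e ◅ w) → _ , e , w })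
                           (FinP.any? (λ b → adj? a b ×-dec walk? n b c))

  reverseWalk : ∀ {n a b} → Walk (Adj H) n a b → Walk (Adj H) n b a
  reverseWalk ε       = ε
  reverseWalk (e ◅ w) = castWalk (ℕP.+-comm _ 1) (reverseWalk w ◅◅ adj-sym e ◅ ε)

  -- r reaches x by a walk; by `shorten`, walks shorter than h suffice,
  -- which makes reachability decidable.
  Reaches : Fin h → Fin h → Set
  Reaches r x = ∃ λ n → n < h × Walk (Adj H) n r x

  reaches? : ∀ r x → Dec (Reaches r x)
  reaches? r x = ℕP.anyUpTo? (λ n → walk? n r x) h

  reaches-refl : ∀ x → Reaches x x
  reaches-refl x = 0 , ℕP.≤-trans (s≤s z≤n) (FinP.toℕ<n x) , ε

  reaches-step : ∀ {r x y} → Reaches r x → Adj H x y → Reaches r y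
  reaches-step (_ , _ , w) e = shorten (w ◅◅ e ◅ ε)

  rootSpec : ∀ x → ∃ λ r → Reaches r x × (∀ r' → r' Fin.< r → ¬ Reaches r' x)
  rootSpec x = least (λ r → reaches? r x) (x , reaches-refl x)

  root : Fin h → Fin h
  root x = proj₁ (rootSpec x)

  root-reaches : ∀ x → Reaches (root x) x
  root-reaches x = proj₁ (proj₂ (rootSpec x))

  root-edge : ∀ {x y} → Adj H x y → root x ≡ root y
  root-edge {x} {y} e with rootSpec x | rootSpec y
  ... | r , rx , minx | s , sy , miny with FinP.<-cmp r s
  ...   | tri< r<s _ _ = contradiction (reaches-step rx e) (miny r r<s)
  ...   | tri≈ _ r≡s _ = r≡s
  ...   | tri> _ _ s<r = contradiction (reaches-step sy (adj-sym e)) (minx s s<r)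

  EvenWalk : Fin h → Fin h → Set
  EvenWalk r x = ∃ λ j → j < suc h × Walk (Adj H) (j + j) r x

  evenWalk? : ∀ r x → Dec (EvenWalk r x)
  evenWalk? r x = ℕP.anyUpTo? (λ j → walk? (j + j) r x) (suc h)

  reaches-even : ∀ {r x y} → Reaches r x → Adj H x y → EvenWalk r x ⊎ EvenWalk r y
  reaches-even (_ , _ , w) e with shorten w
  ... | ℓ , ℓ<h , w' with parity ℓ
  ...   | a , inj₁ refl = inj₁ (a , s≤s (ℕP.≤-trans (ℕP.m≤m+n a a) (ℕP.<⇒≤ ℓ<h)) , w')
  ...   | a , inj₂ refl = inj₂ (suc a , s≤s (ℕP.≤-trans (s≤s (ℕP.m≤m+n a a)) (ℕP.<⇒≤ ℓ<h)) ,
                                castWalk (length a) (w' ◅◅ e ◅ ε))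
    where
    open +-*-Solver
    length : ∀ a → suc (a + a) + 1 ≡ suc a + suc a
    length = solve 1 (λ a → (con 1 :+ (a :+ a)) :+ con 1 := (con 1 :+ a) :+ (con 1 :+ a)) refl

  NoShortOddWalk : Set
  NoShortOddWalk = ∀ a z → a ≤ h + h → ¬ Walk (Adj H) (suc (a + a)) z z

  -- Two even walks from r to the ends of an edge close up to a short odd walk.
  not-both-even : NoShortOddWalk → ∀ {r x y} → Adj H x y → EvenWalk r x → ¬ EvenWalk r y
  not-both-even noOdd e (a , a≤h , wa) (b , b≤h , wb) =
    noOdd (a + b) _ (ℕP.+-mono-≤ (ℕP.≤-pred a≤h) (ℕP.≤-pred b≤h))
      (castWalk (length a b) (wa ◅◅ e ◅ reverseWalk wb))
    where
    open +-*-Solver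
    length : ∀ a b → (a + a) + suc (b + b) ≡ suc ((a + b) + (a + b))
    length = solve 2 (λ a b → (a :+ a) :+ (con 1 :+ (b :+ b)) := con 1 :+ ((a :+ b) :+ (a :+ b))) refl

  colour : Fin h → Fin 2
  colour x = bit (evenWalk? (root x) x)

  -- Adjacent x, y have a common root r; they cannot both have even walks
  -- from r (that closes a short odd walk), nor both lack one (r reaches x).
  twoColouring : NoShortOddWalk → ProperColouring H 2
  twoColouring noOdd = colour , proper
    where
    proper : ∀ x y → Adj H x y → colour x ≢ colour y
    proper x y e same
      with bit-same (evenWalk? (root x) x) (evenWalk? (root x) y)
                    (trans same (cong (λ r → bit (evenWalk? r y)) (sym (root-edge e))))
    ... | inj₁ (ex , ey)   = not-both-even noOdd e ex ey
    ... | inj₂ (¬ex , ¬ey) with reaches-even (root-reaches x) e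
    ...   | inj₁ ex = ¬ex ex
    ...   | inj₂ ey = ¬ey ey

_∷ʳ_ : ∀ {A : Set} {k} → Vector A k → A → Vector A (suc k)
x ∷ʳ b = insertAt x (fromℕ _) b

-- The entry of x at position p, as a natural number (0 past the end).
-- Reading vectors through `at` lets positions be ordinary naturals.
at : ∀ {k m} → Vector (Fin m) k → ℕ → ℕ
at {zero}  x p       = 0
at {suc k} x zero    = toℕ (head x)
at {suc k} x (suc p) = at (tail x) p

at-cong : ∀ {k m} {x y : Vector (Fin m) k} → x ≗ y → ∀ p → at x p ≡ at y p
at-cong {zero}  x≗y p       = refl
at-cong {suc k} x≗y zero    = cong toℕ (x≗y zero)
at-cong {suc k} x≗y (suc p) = at-cong (x≗y ∘ suc) p

at-< : ∀ {k m} (x : Vector (Fin m) k) {p} → p < k → at x p < m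
at-< {suc k} x {zero}  _         = FinP.toℕ<n (head x)
at-< {suc k} x {suc p} (s≤s p<k) = at-< (tail x) p<k

at-∷ʳ : ∀ {k m} (x : Vector (Fin m) k) b {p} → p < k → at (x ∷ʳ b) p ≡ at x p
at-∷ʳ {suc k} x b {zero}  _         = refl
at-∷ʳ {suc k} x b {suc p} (s≤s p<k) = at-∷ʳ (tail x) b p<k

at-∷ʳ-end : ∀ {k m} (x : Vector (Fin m) k) b → at (x ∷ʳ b) k ≡ toℕ b
at-∷ʳ-end {zero}  x b = refl
at-∷ʳ-end {suc k} x b = at-∷ʳ-end (tail x) b

at-last : ∀ {k m} (x : Vector (Fin m) (suc k)) → at x k ≡ toℕ (last x)
at-last {zero}  x = refl
at-last {suc k} x = at-last (tail x)

at-init : ∀ {k m} (x : Vector (Fin m) (suc k)) {p} → p < k → at (init x) p ≡ at x p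
at-init {suc k} x {zero}  _         = refl
at-init {suc k} x {suc p} (s≤s p<k) = at-init (tail x) p<k

at-tabulate : ∀ {k m} (x : Vector (Fin m) k) (g : ℕ → ℕ) →
  (∀ i → toℕ (x i) ≡ g (toℕ i)) → ∀ {p} → p < k → at x p ≡ g p
at-tabulate {suc k} x g entry {zero}  _         = entry zero
at-tabulate {suc k} x g entry {suc p} (s≤s p<k) =
  at-tabulate (tail x) (g ∘ suc) (entry ∘ suc) p<k

-- Its vertices are the sequences x₀ … x_K of
-- numbers below m; there is an arc x → y when x is increasing and y is x
-- shifted one step left with one larger entry appended, i.e. when
-- x₀ < x₁ < ⋯ < x_K < y_K and y_p = x_{p+1}.  (For K = 0: x₀ < y₀.)
Seq : ℕ → ℕ → Set
Seq K m = Vector (Fin m) (suc K)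

module _ {K m : ℕ} where

  Increasing : Seq K m → Set
  Increasing x = ∀ {p} → p < K → at x p < at x (suc p)

  ShiftOf : Seq K m → Seq K m → Set
  ShiftOf x y = ∀ {p} → p < K → at y p ≡ at x (suc p)

  Arc : Seq K m → Seq K m → Set
  Arc x y = Increasing x × Increasing y × ShiftOf x y × at x 0 < at y K

  Link : Seq K m → Seq K m → Set
  Link x y = Arc x y ⊎ Arc y x

  increasing? : ∀ x → Dec (Increasing x)
  increasing? x = ℕP.allUpTo? (λ p → at x p <? at x (suc p)) K

  arc? : ∀ x y → Dec (Arc x y)
  arc? x y = increasing? x ×-dec increasing? y ×-dec
             ℕP.allUpTo? (λ p → at y p ℕP.≟ at x (suc p)) K ×-dec (at x 0 <? at y K)

  link? : ∀ x y → Dec (Link x y)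
  link? x y = arc? x y ⊎-dec arc? y x

  increasing-< : ∀ {x} → Increasing x → ∀ {p q} → p < q → q ≤ K → at x p < at x q
  increasing-< inc {p} {suc q} (s≤s p≤q) q<K with ℕP.m≤n⇒m<n∨m≡n p≤q
  ... | inj₁ p<q  = ℕP.<-trans (increasing-< inc p<q (ℕP.<⇒≤ q<K)) (inc q<K)
  ... | inj₂ refl = inc q<K

  increasing-injective : ∀ {x} → Increasing x → ∀ {p q} → p ≤ K → q ≤ K → at x p ≡ at x q → p ≡ q
  increasing-injective inc {p} {q} p≤K q≤K same with ℕP.<-cmp p q
  ... | tri< p<q _ _ = contradiction same (ℕP.<⇒≢ (increasing-< inc p<q q≤K))
  ... | tri≈ _ p≡q _ = p≡q
  ... | tri> _ _ q<p = contradiction (sym same) (ℕP.<⇒≢ (increasing-< inc q<p p≤K))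

arc-last : ∀ {K m} {x y : Seq K m} → Arc x y → at x K < at y K
arc-last {zero}              (_ , _ , _ , x₀<y₀)  = x₀<y₀
arc-last {suc K} {y = y} (_ , incy , shift , _) =
  subst (_< at y (suc K)) (shift ℕP.≤-refl) (incy ℕP.≤-refl)

increasing-resp : ∀ {K m} {x x' : Seq K m} → x ≗ x' → Increasing x → Increasing x'
increasing-resp x≗x' inc {p} p<K = subst₂ _<_ (at-cong x≗x' p) (at-cong x≗x' (suc p)) (inc p<K)

arc-resp : ∀ {K m} {x x' y y' : Seq K m} → x ≗ x' → y ≗ y' → Arc x y → Arc x' y'
arc-resp {K} x≗x' y≗y' (incx , incy , shift , ends) =
  increasing-resp x≗x' incx , increasing-resp y≗y' incy ,
  (λ {p} p<K → trans (sym (at-cong y≗y' p)) (trans (shift p<K) (at-cong x≗x' (suc p)))) ,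
  subst₂ _<_ (at-cong x≗x' 0) (at-cong y≗y' K) ends

link-resp : ∀ {K m} {x x' y y' : Seq K m} → x ≗ x' → y ≗ y' → Link x y → Link x' y'
link-resp x≗x' y≗y' (inj₁ xy) = inj₁ (arc-resp x≗x' y≗y' xy)
link-resp x≗x' y≗y' (inj₂ yx) = inj₂ (arc-resp y≗y' x≗x' yx)

link-sym : ∀ {K m} {x y : Seq K m} → Link x y → Link y x
link-sym = swap

link-irrefl : ∀ {K m} {x : Seq K m} → ¬ Link x x
link-irrefl (inj₁ xx) = ℕP.<-irrefl refl (arc-last xx)
link-irrefl (inj₂ xx) = ℕP.<-irrefl refl (arc-last xx)

module _ {K m : ℕ} {u w : Seq K m} (uw : Arc u w) where

  private
    z : Seq (suc K) m
    z = u ∷ʳ last w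

    z-init : ∀ {p} → p < suc K → at z p ≡ at u p
    z-init = at-∷ʳ u (last w)

    z-end : at z (suc K) ≡ at w K
    z-end = trans (at-∷ʳ-end u (last w)) (sym (at-last w))

  extend-source-increasing : Increasing (u ∷ʳ last w)
  extend-source-increasing {p} (s≤s p≤K) with ℕP.m≤n⇒m<n∨m≡n p≤K
  ... | inj₁ p<K  = subst₂ _<_ (sym (z-init (ℕP.m≤n⇒m≤1+n p<K))) (sym (z-init (s≤s p<K)))
                      (proj₁ uw p<K)
  ... | inj₂ refl = subst₂ _<_ (sym (z-init ℕP.≤-refl)) (sym z-end) (arc-last uw)

  extend-arc : ∀ {b} → Increasing (w ∷ʳ b) → Arc (u ∷ʳ last w) (w ∷ʳ b)
  extend-arc {b} incz' = extend-source-increasing , incz' , shift , ends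
    where
    z'-init : ∀ {p} → p < suc K → at (w ∷ʳ b) p ≡ at w p
    z'-init = at-∷ʳ w b
    shift : ShiftOf z (w ∷ʳ b)
    shift {p} (s≤s p≤K) with ℕP.m≤n⇒m<n∨m≡n p≤K
    ... | inj₁ p<K  = begin
      at (w ∷ʳ b) p    ≡⟨ z'-init (ℕP.m≤n⇒m≤1+n p<K) ⟩
      at w p           ≡⟨ proj₁ (proj₂ (proj₂ uw)) p<K ⟩
      at u (suc p)     ≡⟨ z-init (s≤s p<K) ⟨
      at z (suc p)     ∎
      where open ≡-Reasoning
    ... | inj₂ refl = trans (z'-init ℕP.≤-refl) (sym z-end)
    ends : at z 0 < at (w ∷ʳ b) (suc K)
    ends = begin-strict
      at z 0            ≡⟨ z-init (s≤s z≤n) ⟩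
      at u 0            <⟨ proj₂ (proj₂ (proj₂ uw)) ⟩
      at w K            ≡⟨ z'-init ℕP.≤-refl ⟨
      at (w ∷ʳ b) K     <⟨ incz' ℕP.≤-refl ⟩
      at (w ∷ʳ b) (suc K) ∎
      where open ℕP.≤-Reasoning

ShiftColouring : ℕ → ℕ → ℕ → Set
ShiftColouring K m c = Σ (Seq K m → Fin c) λ col → ∀ {x y} → Arc x y → col x ≢ col y

-- S(0, m) is complete (a < b gives an arc a → b), so it needs m colours.
colouring-S₀ : ∀ {m c} → ShiftColouring 0 m c → m ≤ c
colouring-S₀ {m} (col , proper) = FinP.injective⇒≤ injective
  where
  single : Fin m → Seq 0 m
  single a _ = a
  arc : ∀ {a b} → a Fin.< b → Arc (single a) (single b)
  arc a<b = (λ ()) , (λ ()) , (λ ()) , a<b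
  injective : ∀ {a b} → col (single a) ≡ col (single b) → a ≡ b
  injective {a} {b} same with FinP.<-cmp a b
  ... | tri< a<b _ _ = contradiction same (proper (arc a<b))
  ... | tri≈ _ a≡b _ = a≡b
  ... | tri> _ _ b<a = contradiction (sym same) (proper (arc b<a))

-- From a c-colouring of S(K + 1, m) we get a 2^c-colouring of S(K, m):
-- colour u by the set of colours of its increasing one-entry extensions.
colouring-step : ∀ {K m c} → ShiftColouring (suc K) m c → ShiftColouring K m (2 ^ c)
colouring-step {K} {m} {c} (col , proper) = col' , proper'
  where
  Extends : Seq K m → Fin c → Set
  Extends u i = ∃ λ b → Increasing (u ∷ʳ b) × col (u ∷ʳ b) ≡ i
  extends? : ∀ u i → Dec (Extends u i)
  extends? u i = FinP.any? (λ b → increasing? (u ∷ʳ b) ×-dec (col (u ∷ʳ b) FinP.≟ i))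
  col' : Seq K m → Fin (2 ^ c)
  col' u = funToFin (λ i → bit (extends? u i))
  -- Let u → w and let z extend u by the last entry of w.  The colour of z is
  -- among u's extension colours; if u and w get the same set, it is also the
  -- colour of an increasing extension z' of w, and z → z' is a monochromatic arc.
  proper' : ∀ {u w} → Arc u w → col' u ≢ col' w
  proper' {u} {w} uw same
    with bit-same (extends? u (col (u ∷ʳ last w))) (extends? w (col (u ∷ʳ last w)))
                  (funToFin-pointwise same (col (u ∷ʳ last w)))
  ... | inj₁ (_ , (_ , incz' , col-z')) = proper (extend-arc uw incz') (sym col-z')
  ... | inj₂ (¬extends , _)           = ¬extends (last w , extend-source-increasing uw , refl)

tower : ℕ → ℕ → ℕ
tower zero    c = c
tower (suc K) c = tower K (2 ^ c)

tower-mono : ∀ K {c d} → c ≤ d → tower K c ≤ tower K d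
tower-mono zero    c≤d = c≤d
tower-mono (suc K) c≤d = tower-mono K (ℕP.^-monoʳ-≤ 2 c≤d)

colouring-bound : ∀ K {m c} → ShiftColouring K m c → m ≤ tower K c
colouring-bound zero    colouring = colouring-S₀ colouring
colouring-bound (suc K) colouring = colouring-bound K (colouring-step colouring)

module _ {K m : ℕ} where

  -- Along a walk in S(K, m) of length L from x to y that traverses j arcs
  -- backwards, the entries of x reappear in y shifted by L − 2j positions.
  Aligned : ℕ → Seq K m → Seq K m → Set
  Aligned L x y = ∃ λ j → j ≤ L × (∀ p → p + L + L ≤ K → at x (p + L) ≡ at y (p + (j + j)))

  walk-aligned : ∀ {L x y} → Walk Link L x y → Aligned L x y
  walk-aligned ε = 0 , z≤n , λ _ _ → refl
  walk-aligned {suc L} {x} {y} (_◅_ {b = x'} (inj₁ (_ , _ , shift , _)) w) with walk-aligned w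
  ... | j , j≤L , aligned = j , ℕP.m≤n⇒m≤1+n j≤L , λ p bound → begin
      at x (p + suc L)    ≡⟨ cong (at x) (ℕP.+-suc p L) ⟩
      at x (suc (p + L))  ≡⟨ shift (inside p bound) ⟨
      at x' (p + L)       ≡⟨ aligned p (shrink p bound) ⟩
      at y (p + (j + j))  ∎
    where
    open ≡-Reasoning
    inside : ∀ p → p + suc L + suc L ≤ K → p + L < K
    inside p bound = ℕP.≤-trans (ℕP.≤-reflexive (sym (ℕP.+-suc p L))) (ℕP.≤-trans (ℕP.m≤m+n _ _) bound)
    shrink : ∀ p → p + suc L + suc L ≤ K → p + L + L ≤ K
    shrink p = ℕP.≤-trans (ℕP.+-mono-≤ (ℕP.+-monoʳ-≤ p (ℕP.n≤1+n L)) (ℕP.n≤1+n L))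
  walk-aligned {suc L} {x} {y} (_◅_ {b = x'} (inj₂ (_ , _ , shift , _)) w) with walk-aligned w
  ... | j , j≤L , aligned = suc j , s≤s j≤L , λ p bound → begin
      at x (p + suc L)              ≡⟨ shift (ℕP.<-≤-trans (ℕP.m<m+n (p + suc L) (s≤s z≤n)) bound) ⟩
      at x' (suc (p + suc L))       ≡⟨ cong (at x') (shift₂ p L) ⟩
      at x' (suc (suc p) + L)       ≡⟨ aligned (suc (suc p)) (subst (_≤ K) (bound₂ p L) bound) ⟩
      at y (suc (suc p) + (j + j))  ≡⟨ cong (at y) (shift₃ p j) ⟩
      at y (p + (suc j + suc j))    ∎
    where
    open ≡-Reasoning
    open +-*-Solver
    shift₂ : ∀ p L → suc (p + suc L) ≡ suc (suc p) + L
    shift₂ = solve 2 (λ p L → con 1 :+ (p :+ (con 1 :+ L)) := (con 2 :+ p) :+ L) refl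
    bound₂ : ∀ p L → p + suc L + suc L ≡ suc (suc p) + L + L
    bound₂ = solve 2 (λ p L → p :+ (con 1 :+ L) :+ (con 1 :+ L) := (con 2 :+ p) :+ L :+ L) refl
    shift₃ : ∀ p j → suc (suc p) + (j + j) ≡ p + (suc j + suc j)
    shift₃ = solve 2 (λ p j → (con 2 :+ p) :+ (j :+ j) := p :+ ((con 1 :+ j) :+ (con 1 :+ j))) refl

  -- A closed walk of odd length L returns every entry of an increasing x
  -- shifted by an odd amount, which is impossible as long as 2L ≤ K:
  -- S(K, m) has no odd closed walks of length at most K / 2.
  no-short-odd-walk : ∀ a {x} → suc (a + a) + suc (a + a) ≤ K → ¬ Walk Link (suc (a + a)) x x
  no-short-odd-walk a {x} bound w with walk-aligned w
  ... | j , j≤L , aligned =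
    odd≢even a j (increasing-injective (start-increasing w)
      (ℕP.≤-trans (ℕP.m≤m+n _ _) bound)
      (ℕP.≤-trans (ℕP.+-mono-≤ j≤L j≤L) bound)
      (aligned 0 bound))
    where
    start-increasing : ∀ {n} {x y : Seq K m} → Walk Link (suc n) x y → Increasing x
    start-increasing (inj₁ (incx , _) ◅ _)     = incx
    start-increasing (inj₂ (_ , incx , _) ◅ _) = incx

-- The
-- vertex set is viewed as M blocks {combine i j | j : Fin t} of size t.
module Induced {A : Set} {L : A → A → Set} (L? : ∀ a b → Dec (L a b))
               (L-sym : ∀ {a b} → L a b → L b a) (L-irrefl : ∀ {a} → ¬ L a a)
               {M t : ℕ} (f : Fin (M * t) → A) where

  induced : Graph
  induced = record
    { size   = M * t
    ; adj    = λ u w → isYes (L? (f u) (f w))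
    ; sym    = λ u w → isYes-⇔ L-sym L-sym (L? (f u) (f w)) (L? (f w) (f u))
    ; irrefl = λ u → isYes-false (L? (f u) (f u)) L-irrefl
    }

  adj⇒L : ∀ {u w} → Adj induced u w → L (f u) (f w)
  adj⇒L {u} {w} = isYes-sound (L? (f u) (f w))

  L⇒adj : ∀ {u w} → L (f u) (f w) → Adj induced u w
  L⇒adj {u} {w} = isYes-complete (L? (f u) (f w))

  block-degree : ∀ u i → (∀ j → L (f u) (f (Fin.combine i j))) → t ≤ degree induced u
  block-degree u i related = begin
      t                                       ≤⟨ t≤sum t (indicator ∘ Fin.combine i) (adjacent ∘ L⇒adj ∘ related) ⟩
      sum (tabulate (indicator ∘ Fin.combine i)) ≤⟨ sum-block≤ M t indicator i ⟩
      sum (tabulate indicator)                ≡⟨ cong sum (ListP.map-tabulate id indicator) ⟨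
      degree induced u                        ∎
    where
    open ℕP.≤-Reasoning
    indicator : Fin (M * t) → ℕ
    indicator w = if adj induced u w then 1 else 0
    adjacent : ∀ {w} → Adj induced u w → 1 ≤ indicator w
    adjacent u~w = subst (λ b → 1 ≤ (if b then 1 else 0)) (sym u~w) ℕP.≤-refl

record ShiftBlowUp (K m M t : ℕ) : Set where
  field
    graph           : Graph
    size≡           : size graph ≡ M * t
    degree-≥        : ∀ u → t ≤ degree graph u
    hom             : Fin (size graph) → Seq K m
    hom-link        : ∀ {u w} → Adj graph u w → Link (hom u) (hom w)
    colouring-shift : ∀ {c} → ProperColouring graph c → ShiftColouring K m c

-- Blowing up S(K, m), K = K' + 1 and m = m' + 1 with K < m', by a factor
-- t = t' + 1.  Given a coding of the sequences by Fin M, the vertex set is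
-- Fin (M * t), and the vertex combine i j (j : Fin t) stands for the sequence
-- decoded from i when that is a good vertex (one with a neighbour) and for
-- the good vertex 0, 1, …, K otherwise.  Every vertex then has t neighbours
-- (the copies of one neighbour), while walks and colourings transfer to S(K, m).
module BlowUp (K' m' : ℕ) (room : suc K' < m') {M : ℕ}
              (code : Seq (suc K') (suc m') → Fin M) (decode : Fin M → Seq (suc K') (suc m'))
              (decode-code : ∀ z → decode (code z) ≗ z) (t' : ℕ) where

  K m t : ℕ
  K = suc K'
  m = suc m'
  t = suc t'

  -- Good vertices: increasing, and shiftable down (x₀ > 0) or up (x_K < m − 1).
  Good : Seq K m → Set
  Good x = Increasing x × (0 < at x 0 ⊎ at x K < m')

  good? : ∀ x → Dec (Good x)
  good? x = increasing? x ×-dec ((0 <? at x 0) ⊎-dec (at x K <? m'))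

  good-resp : ∀ {x x'} → x ≗ x' → Good x → Good x'
  good-resp x≗x' (inc , inj₁ bottom) = increasing-resp x≗x' inc , inj₁ (subst (0 <_) (at-cong x≗x' 0) bottom)
  good-resp x≗x' (inc , inj₂ top)    = increasing-resp x≗x' inc , inj₂ (subst (_< m') (at-cong x≗x' K) top)

  arc-source-good : ∀ {x y} → Arc x y → Good x
  arc-source-good {y = y} xy@(incx , _) =
    incx , inj₂ (ℕP.<-≤-trans (arc-last xy) (ℕP.≤-pred (at-< y ℕP.≤-refl)))

  arc-target-good : ∀ {x y} → Arc x y → Good y
  arc-target-good (incx , incy , shift , _) =
    incy , inj₁ (subst (0 <_) (sym (shift (s≤s z≤n))) (ℕP.≤-<-trans z≤n (incx (s≤s z≤n))))

  shift-up : ∀ {z} → Increasing z → at z K < m' → ∃ λ z' → Good z' × Arc z z'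
  shift-up {z} incz top = z' , (incz' , inj₁ bottom) , (incz , incz' , shift , ends)
    where
    z' : Seq K m
    z' = tail z ∷ʳ fromℕ m'
    shift : ShiftOf z z'
    shift = at-∷ʳ (tail z) (fromℕ m')
    z'-end : at z' K ≡ m'
    z'-end = trans (at-∷ʳ-end (tail z) (fromℕ m')) (FinP.toℕ-fromℕ m')
    incz' : Increasing z'
    incz' {p} p<K with ℕP.m≤n⇒m<n∨m≡n p<K
    ... | inj₁ p+1<K = subst₂ _<_ (sym (shift p<K)) (sym (shift p+1<K)) (incz p+1<K)
    ... | inj₂ refl  = subst₂ _<_ (sym (shift p<K)) (sym z'-end) top
    bottom : 0 < at z' 0
    bottom = subst (0 <_) (sym (shift (s≤s z≤n))) (ℕP.≤-<-trans z≤n (incz (s≤s z≤n)))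
    ends : at z 0 < at z' K
    ends = subst (at z 0 <_) (sym z'-end)
             (ℕP.<-trans (increasing-< incz (s≤s z≤n) ℕP.≤-refl) top)

  shift-down : ∀ {z} → Increasing z → 0 < at z 0 → ∃ λ z' → Good z' × Arc z' z
  shift-down {z} incz bottom = z' , (incz' , inj₂ top) , (incz' , incz , shift , ends)
    where
    z' : Seq K m
    z' = zero ∷ init z
    shift : ShiftOf z' z
    shift p<K = sym (at-init z p<K)
    incz' : Increasing z'
    incz' {zero}  _          = subst (0 <_) (shift (s≤s z≤n)) bottom
    incz' {suc p} (s≤s p<K') =
      subst₂ _<_ (shift (ℕP.m≤n⇒m≤1+n p<K')) (shift (s≤s p<K')) (incz (ℕP.m≤n⇒m≤1+n p<K'))
    top : at z' K < m'
    top = ℕP.<-≤-trans (subst (_< at z K) (shift ℕP.≤-refl) (incz ℕP.≤-refl))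
                       (ℕP.≤-pred (at-< z ℕP.≤-refl))
    ends : at z' 0 < at z K
    ends = ℕP.<-≤-trans bottom (ℕP.<⇒≤ (increasing-< incz (s≤s z≤n) ℕP.≤-refl))

  neighbour : ∀ {z} → Good z → ∃ λ z' → Good z' × Link z z'
  neighbour (incz , inj₁ bottom) with shift-down incz bottom
  ... | z' , good , arc = z' , good , inj₂ arc
  neighbour (incz , inj₂ top) with shift-up incz top
  ... | z' , good , arc = z' , good , inj₁ arc

  -- The good vertex 0, 1, …, K, standing in for the vertices without neighbours.
  base : Seq K m
  base i = fromℕ< (ℕP.<-≤-trans (FinP.toℕ<n i) (ℕP.m≤n⇒m≤1+n room))

  at-base : ∀ {p} → p < suc K → at base p ≡ p
  at-base = at-tabulate base id (λ i → FinP.toℕ-fromℕ< _)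

  base-good : Good base
  base-good = (λ {p} p<K → subst₂ _<_ (sym (at-base (ℕP.m≤n⇒m≤1+n p<K))) (sym (at-base (s≤s p<K))) ℕP.≤-refl) ,
              inj₂ (subst (_< m') (sym (at-base ℕP.≤-refl)) room)

  project : Seq K m → Seq K m
  project x with good? x
  ... | yes _ = x
  ... | no _  = base

  project-good : ∀ x → Good (project x)
  project-good x with good? x
  ... | yes good = good
  ... | no _     = base-good

  project-id : ∀ {x} → Good x → project x ≡ x
  project-id {x} good with good? x
  ... | yes _  = refl
  ... | no bad = contradiction good bad

  vertex : Fin (M * t) → Seq K m
  vertex u = project (decode (Fin.quotient t u))

  copy : Seq K m → Fin t → Fin (M * t)
  copy z j = Fin.combine (code z) j

  decode-copy : ∀ z j → decode (Fin.quotient t (copy z j)) ≗ z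
  decode-copy z j i = trans (cong (λ rq → decode (proj₁ rq) i) (FinP.remQuot-combine (code z) j))
                            (decode-code z i)

  vertex-copy : ∀ {z} j → Good z → vertex (copy z j) ≗ z
  vertex-copy {z} j good i =
    trans (cong (λ x → x i) (project-id (good-resp (sym ∘ decode-copy z j) good))) (decode-copy z j i)

  open Induced link? link-sym link-irrefl {M} {t} vertex public renaming (induced to G)

  linked-copies : ∀ {x z'} → Good z' → Link x z' → ∀ j → Link x (vertex (copy z' j))
  linked-copies good link j = link-resp (λ _ → refl) (sym ∘ vertex-copy j good) link

  -- Every vertex represents a good sequence, which has a good neighbour z';
  -- it is adjacent to all t copies of z'.
  degree-≥ : ∀ u → t ≤ degree G u
  degree-≥ u = adjacent-block (neighbour (project-good (decode (Fin.quotient t u))))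
    where
    adjacent-block : (∃ λ z' → Good z' × Link (vertex u) z') → t ≤ degree G u
    adjacent-block (z' , good , link) = block-degree u (code z') (linked-copies good link)

  -- A proper colouring of G restricts to one of S(K, m) on the first copies.
  shift-colouring : ∀ {c} → ProperColouring G c → ShiftColouring K m c
  shift-colouring (col , proper) = (λ z → col (copy z zero)) , λ xy →
    proper _ _ (L⇒adj (inj₁ (arc-resp (sym ∘ vertex-copy zero (arc-source-good xy))
                                      (sym ∘ vertex-copy zero (arc-target-good xy)) xy)))

  blown-up : ShiftBlowUp K m M t
  blown-up = record
    { graph = G ; size≡ = refl ; degree-≥ = degree-≥ ; hom = vertex ; hom-link = adj⇒L
    ; colouring-shift = shift-colouring }

blow-up : ∀ K' m' t' → suc K' < m' → ShiftBlowUp (suc K') (suc m') (suc m' ^ suc (suc K')) (suc t')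
blow-up K' m' t' room = BlowUp.blown-up K' m' room funToFin finToFun FinP.finToFun-funToFin t'

≤∣∣ : ∀ q → q ℚ.≤ ℚ.∣ q ∣
≤∣∣ (ℚ.mkℚ (+ _)    _ _) = ℚP.≤-refl
≤∣∣ (ℚ.mkℚ -[1+ _ ] _ _) = ℚ.*≤* ℤ.-≤+

/-≤ : ∀ n d k → n ≤ (1 + k) * d → (+ n) ℚ./ (1 + k) ℚ.≤ (+ d) ℚ./ 1
/-≤ n d k n≤ = ℚP.toℚᵘ-cancel-≤ (begin
    ℚ.toℚᵘ ((+ n) ℚ./ suc k)  ≃⟨ ℚP.toℚᵘ-fromℚᵘ (ℚᵘ.mkℚᵘ (+ n) k) ⟩
    ℚᵘ.mkℚᵘ (+ n) k           ≤⟨ ℚᵘ.*≤* cross ⟩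
    ℚᵘ.mkℚᵘ (+ d) 0           ≃⟨ ℚP.toℚᵘ-fromℚᵘ (ℚᵘ.mkℚᵘ (+ d) 0) ⟨
    ℚ.toℚᵘ ((+ d) ℚ./ 1)      ∎)
  where
  open ℚᵘP.≤-Reasoning
  cross : (+ n) ℤ.* (+ 1) ℤ.≤ (+ d) ℤ.* (+ suc k)
  cross = subst (ℤ._≤ _) (ℤP.pos-* n 1) (subst (_ ℤ.≤_) (ℤP.pos-* d (suc k))
            (ℤ.+≤+ (subst₂ _≤_ (sym (ℕP.*-identityʳ n)) (ℕP.*-comm (suc k) d) n≤)))

≤-degree : ∀ q M t d → ℚ.∣ q ∣ ℚ.≤ (+ (M * t)) ℚ./ (1 + M) → t ≤ d → q ℚ.≤ (+ d) ℚ./ 1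
≤-degree q M t d small t≤d = ℚP.≤-trans (≤∣∣ q) (ℚP.≤-trans small
  (/-≤ (M * t) d M (ℕP.≤-trans (ℕP.*-monoʳ-≤ M t≤d) (ℕP.m≤n+m (M * d) d))))

δ≥-from-degrees : ∀ (G : Graph) q M t → (∀ u → t ≤ degree G u) →
  ℚ.∣ q ∣ ℚ.≤ (+ (M * t)) ℚ./ (1 + M) → δ≥ G q
δ≥-from-degrees G q M t t≤degree small u = ≤-degree q M t (degree G u) small (t≤degree u)

blow-up-works : (H : Graph) → χ≥ H 3 → (f : ℕ → ℚ) → (C n₁ K m M t : ℕ) →
  (∀ a → a ≤ size H + size H → suc (a + a) + suc (a + a) ≤ K) → tower K C < m →
  ℚ.∣ f (M * t) ∣ ℚ.≤ (+ (M * t)) ℚ./ (1 + M) → n₁ ≤ M * t → ShiftBlowUp K m M t →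
  Σ Graph λ G → Free H G × (n₁ ≤ v G) × δ≥ G (f (v G)) × χ≥ G C
blow-up-works H χH≥3 f C n₁ K m M t girth tall small large B =
  graph , H-free ,
  subst (n₁ ≤_) (sym size≡) large ,
  subst (λ n → δ≥ graph (f n)) (sym size≡) (δ≥-from-degrees graph (f (M * t)) M t degree-≥ small) ,
  chromatic
  where
  open ShiftBlowUp B

  -- A copy of H in G maps to S(K, m), where odd closed walks are long;
  -- so H would be 2-colourable.
  H-free : Free H graph
  H-free (φ , _ , φ-hom) = χH≥3 2 (s≤s (s≤s (s≤s z≤n))) (TwoColouring.twoColouring H no-odd)
    where
    no-odd : TwoColouring.NoShortOddWalk H
    no-odd a _ a≤2h w =
      no-short-odd-walk a (girth a a≤2h) (mapWalk (hom ∘ φ) (λ {a} {b} e → hom-link (φ-hom a b e)) w)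

  -- A colouring with k < C colours transfers to S(K, m), forcing m ≤ tower K k ≤ tower K C.
  chromatic : χ≥ graph C
  chromatic k k<C colouring =
    ℕP.<⇒≱ (ℕP.≤-<-trans (tower-mono K (ℕP.<⇒≤ k<C)) tall) (colouring-bound K (colouring-shift colouring))

proposition8p2 : (H : Graph) → χ≥ H 3 → (f : ℕ → ℚ) → LittleO-n f →
    (C n₁ : ℕ) → Σ Graph λ G →
      Free H G × (n₁ ≤ v G) × δ≥ G (f (v G)) × χ≥ G C
proposition8p2 H χH≥3 f f=o[n] C n₁ =
  blow-up-works H χH≥3 f C n₁ K m M t girth tall (proj₂ (f=o[n] M) (M * t) N₀≤n) n₁≤n
    (blow-up K' m' t' (ℕP.m≤m+n (suc K) (tower K C)))
  where
  L K' K m' m M N₀ t' t : ℕ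
  L  = suc ((size H + size H) + (size H + size H))
  K' = L + L
  K  = suc K'
  m' = suc K + tower K C
  m  = suc m'
  M  = m ^ suc K
  N₀ = proj₁ (f=o[n] M)
  t' = N₀ + n₁
  t  = suc t'

  girth : ∀ a → a ≤ size H + size H → suc (a + a) + suc (a + a) ≤ K
  girth a a≤2h = ℕP.m≤n⇒m≤1+n (ℕP.+-mono-≤ (s≤s (ℕP.+-mono-≤ a≤2h a≤2h)) (s≤s (ℕP.+-mono-≤ a≤2h a≤2h)))

  tall : tower K C < m
  tall = s≤s (ℕP.m≤n+m (tower K C) (suc K))

  t≤n : t ≤ M * t
  t≤n = ℕP.m≤n*m t M {{ℕ.>-nonZero (ℕP.m^n>0 m (suc K))}}

  N₀≤n : N₀ ≤ M * t
  N₀≤n = ℕP.≤-trans (ℕP.≤-trans (ℕP.m≤m+n N₀ n₁) (ℕP.n≤1+n t')) t≤n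

  n₁≤n : n₁ ≤ M * t
  n₁≤n = ℕP.≤-trans (ℕP.≤-trans (ℕP.m≤n+m n₁ N₀) (ℕP.n≤1+n t')) t≤n
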